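{- Let $k\ge 1$ and $n\ge 3k-1$. Then the Kneser graph $K(n,k)$ has a complete conflict-free coloring with $k+2$ colors; that is, $\chi_{CF}(K(n,k))\le k+2$.
   Context: The Kneser graph $K(n,k)$ has as vertices the $k$-element subsets of $\{1,\dots,n\}$, two being adjacent iff they are disjoint. A complete conflict-free coloring with $m$ colors is a map $C:V\to\{1,\dots,m\}$ such that every vertex $v$ has some color $i$ with $|N(v)\cap C^{ -1}(i)|=1$, where $N(v)$ is the open neighborhood; $\chi_{CF}$ is the minimum such $m$. -}

module Defs where

open import Data.Nat using (ℕ)
open import Data.Fin using (Fin)
open import Data.Fin.Subset using (Subset; ∣_∣; _∩_; Empty)
open import Data.Product using (Σ; ∃; _×_; _,_; proj₁)
open import Relation.Binary.PropositionalEquality using (_≡_)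

KVertex : ℕ → ℕ → Set
KVertex n k = Σ (Subset n) λ s → ∣ s ∣ ≡ k

KAdj : ∀ {n k} → KVertex n k → KVertex n k → Set
KAdj (s , _) (t , _) = Empty (s ∩ t)

UniqueInNbhd : ∀ {n k m} → (KVertex n k → Fin m) → KVertex n k → Fin m → Set
UniqueInNbhd {n} {k} C v i =
  ∃ λ (w : KVertex n k) → KAdj v w × C w ≡ i ×
    ((w' : KVertex n k) → KAdj v w' → C w' ≡ i → proj₁ w' ≡ proj₁ w)

IsCompleteCFColoring : (n k m : ℕ) → (KVertex n k → Fin m) → Set
IsCompleteCFColoring n k m C = (v : KVertex n k) → ∃ λ (i : Fin m) → UniqueInNbhd C v i

HasCompleteCFColoring : (n k m : ℕ) → Set
HasCompleteCFColoring n k m = Σ (KVertex n k → Fin m) (IsCompleteCFColoring n k m)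

module Submission where

-- Let W be the set of the first 2k points of the ground set.  A vertex w
-- (a k-set) contained in W gets the colour "index of the least element of
-- w", which is at most k; every other vertex gets the colour k+1.
-- Given a vertex v, the set W ∖ v has at least k elements; let T be the set
-- of its k largest elements and j the least element of T.  Then T is a
-- neighbour of v of colour j, and it is the only one: a neighbour w of
-- colour j lies in W ∖ v and has no element below j, hence w ⊆ T, and
-- |w| = |T| forces w = T.

open import Defs
open import Data.Nat using (ℕ; zero; suc; _≤_; _<_; _+_; _*_; _∸_; z≤n; s≤s; s≤s⁻¹; _≤?_)
open import Data.Nat.Properties
open import Data.Vec using ([]; _∷_; here; there)
open import Data.Fin using (Fin; zero; fromℕ<; toℕ)
open import Data.Fin.Properties using (toℕ-fromℕ<)
open import Data.Fin.Subset
open import Data.Fin.Subset.Properties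
open import Data.Product using (∃; _×_; _,_; proj₁; proj₂)
open import Function using (_∘_)
open import Relation.Nullary using (Dec; yes; no; contradiction)
open import Relation.Binary.PropositionalEquality

private
  variable
    m : ℕ

below : (m r : ℕ) → Subset m
below zero    r       = []
below (suc m) zero    = outside ∷ below m zero
below (suc m) (suc r) = inside ∷ below m r

∣below∣≤r : ∀ m r → ∣ below m r ∣ ≤ r
∣below∣≤r zero    r       = z≤n
∣below∣≤r (suc m) zero    = ∣below∣≤r m zero
∣below∣≤r (suc m) (suc r) = s≤s (∣below∣≤r m r)

∣below∣≡r : ∀ m r → r ≤ m → ∣ below m r ∣ ≡ r
∣below∣≡r m       zero    _         = n≤0⇒n≡0 (∣below∣≤r m zero)
∣below∣≡r (suc m) (suc r) (s≤s r≤m) = cong suc (∣below∣≡r m r r≤m)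

-- The index of the least element of a subset (m for the empty subset).
lead : Subset m → ℕ
lead []            = 0
lead (inside ∷ p)  = 0
lead (outside ∷ p) = suc (lead p)

from : ℕ → Subset m → Subset m
from zero    p       = p
from (suc j) []      = []
from (suc j) (_ ∷ p) = outside ∷ from j p

from-⊆ : ∀ j (p : Subset m) → from j p ⊆ p
from-⊆ zero    p       = λ x∈p → x∈p
from-⊆ (suc j) []      = λ ()
from-⊆ (suc j) (_ ∷ p) = out⊆ (from-⊆ j p)

⊆-from : ∀ j {w p : Subset m} → j ≤ lead w → w ⊆ p → w ⊆ from j p
⊆-from zero    _         w⊆p = w⊆p
⊆-from (suc j) {[]} {[]} _ w⊆p = w⊆p
⊆-from (suc j) {outside ∷ w} {_ ∷ p} (s≤s j≤lead) w⊆p =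
  out⊆ (⊆-from j j≤lead (drop-∷-⊆ w⊆p))

-- The k largest elements of p: if 1 ≤ k ≤ |p| then some threshold j cuts
-- off exactly k elements of p, and the least of them is j itself.
topSegment : ∀ k (p : Subset m) → 1 ≤ k → k ≤ ∣ p ∣ →
             ∃ λ j → ∣ from j p ∣ ≡ k × lead (from j p) ≡ j
topSegment k []            1≤k k≤0 = contradiction (≤-trans 1≤k k≤0) λ ()
topSegment k (outside ∷ p) 1≤k k≤∣p∣ with topSegment k p 1≤k k≤∣p∣
... | j , size , least = suc j , size , cong suc least
topSegment k (inside ∷ p)  1≤k k≤1+∣p∣ with k ≤? ∣ p ∣
... | yes k≤∣p∣ = let (j , size , least) = topSegment k p 1≤k k≤∣p∣
                  in suc j , size , cong suc least
... | no  k≰∣p∣ = 0 , ≤-antisym (≰⇒> k≰∣p∣) k≤1+∣p∣ , refl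

lead+∣w∣≤r : ∀ {m} r {w : Subset m} → w ⊆ below m r → 1 ≤ ∣ w ∣ → lead w + ∣ w ∣ ≤ r
lead+∣w∣≤r {m} zero {w} w⊆ 1≤∣w∣ =
  contradiction (≤-trans 1≤∣w∣ (≤-trans (p⊆q⇒∣p∣≤∣q∣ w⊆) (∣below∣≤r m zero))) λ ()
lead+∣w∣≤r (suc r) {[]} _ ()
lead+∣w∣≤r {suc m} (suc r) {inside ∷ w} w⊆ _ =
  s≤s (≤-trans (p⊆q⇒∣p∣≤∣q∣ (drop-∷-⊆ w⊆)) (∣below∣≤r m r))
lead+∣w∣≤r (suc r) {outside ∷ w} w⊆ 1≤∣w∣ =
  s≤s (lead+∣w∣≤r r (drop-∷-⊆ w⊆) 1≤∣w∣)

⊆-size-≡ : {p q : Subset m} → p ⊆ q → ∣ q ∣ ≤ ∣ p ∣ → p ≡ q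
⊆-size-≡ {p = []}          {[]}          _   _ = refl
⊆-size-≡ {p = outside ∷ p} {outside ∷ q} p⊆q q≤p = cong (outside ∷_) (⊆-size-≡ (drop-∷-⊆ p⊆q) q≤p)
⊆-size-≡ {p = outside ∷ p} {inside  ∷ q} p⊆q 1+q≤p =
  contradiction (≤-trans 1+q≤p (p⊆q⇒∣p∣≤∣q∣ (drop-∷-⊆ p⊆q))) (1+n≰n)
⊆-size-≡ {p = inside  ∷ p} {outside ∷ q} p⊆q _   = contradiction (p⊆q here) λ ()
⊆-size-≡ {p = inside  ∷ p} {inside  ∷ q} p⊆q q≤p = cong (inside ∷_) (⊆-size-≡ (drop-∷-⊆ p⊆q) (s≤s⁻¹ q≤p))

∣p∣≤∣p─q∣+∣q∣ : ∀ (p q : Subset m) → ∣ p ∣ ≤ ∣ p ─ q ∣ + ∣ q ∣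
∣p∣≤∣p─q∣+∣q∣ []            []            = z≤n
∣p∣≤∣p─q∣+∣q∣ (inside  ∷ p) (inside  ∷ q) =
  ≤-trans (s≤s (∣p∣≤∣p─q∣+∣q∣ p q)) (≤-reflexive (sym (+-suc ∣ p ─ q ∣ ∣ q ∣)))
∣p∣≤∣p─q∣+∣q∣ (outside ∷ p) (inside  ∷ q) =
  ≤-trans (∣p∣≤∣p─q∣+∣q∣ p q) (+-monoʳ-≤ ∣ p ─ q ∣ (n≤1+n ∣ q ∣))
∣p∣≤∣p─q∣+∣q∣ (inside  ∷ p) (outside ∷ q) = s≤s (∣p∣≤∣p─q∣+∣q∣ p q)
∣p∣≤∣p─q∣+∣q∣ (outside ∷ p) (outside ∷ q) = ∣p∣≤∣p─q∣+∣q∣ p q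

∈─⇒∉ : ∀ (p q : Subset m) {x} → x ∈ p ─ q → x ∉ q
∈─⇒∉ (inside  ∷ p) (outside ∷ q) here       = λ ()
∈─⇒∉ (outside ∷ p) (outside ∷ q) {zero} ()
∈─⇒∉ (_       ∷ p) (inside  ∷ q) {zero} ()
∈─⇒∉ (_       ∷ p) (_       ∷ q) (there x∈) = ∈─⇒∉ p q x∈ ∘ drop-there

module ConflictFree {n k : ℕ} (1≤k : 1 ≤ k) (2k≤n : k + k ≤ n) where

  W : Subset n
  W = below n (k + k)

  hue : (w : Subset n) → Dec (w ⊆ W) → ℕ
  hue w (yes _) = lead w
  hue w (no  _) = suc k

  hue-⊆ : {w : Subset n} → w ⊆ W → (d : Dec (w ⊆ W)) → hue w d ≡ lead w
  hue-⊆ _   (yes _)   = refl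
  hue-⊆ w⊆W (no  w⊈W) = contradiction (λ {x} → w⊆W {x}) w⊈W

  hue≤k : ∀ {w j} (d : Dec (w ⊆ W)) → hue w d ≡ j → j ≤ k → w ⊆ W × lead w ≡ j
  hue≤k (yes w⊆W) hue≡j _   = w⊆W , hue≡j
  hue≤k (no  _)   refl  j≤k = contradiction j≤k 1+n≰n

  lead≤k : {w : Subset n} → w ⊆ W → ∣ w ∣ ≡ k → lead w ≤ k
  lead≤k {w} w⊆W ∣w∣≡k = +-cancelʳ-≤ k (lead w) k lead+k≤k+k
    where
    lead+k≤k+k : lead w + k ≤ k + k
    lead+k≤k+k = subst (λ s → lead w + s ≤ k + k) ∣w∣≡k
                   (lead+∣w∣≤r (k + k) w⊆W (subst (1 ≤_) (sym ∣w∣≡k) 1≤k))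

  hue<k+2 : (w : KVertex n k) (d : Dec (proj₁ w ⊆ W)) → hue (proj₁ w) d < k + 2
  hue<k+2 (w , ∣w∣≡k) (yes w⊆W) = begin-strict
    lead w  ≤⟨ lead≤k w⊆W ∣w∣≡k ⟩
    k       <⟨ n<1+n k ⟩
    suc k   <⟨ n<1+n (suc k) ⟩
    2 + k   ≡⟨ +-comm 2 k ⟩
    k + 2   ∎
    where open ≤-Reasoning
  hue<k+2 _ (no _) = ≤-reflexive (+-comm 2 k)

  colour : KVertex n k → Fin (k + 2)
  colour w = fromℕ< (hue<k+2 w (proj₁ w ⊆? W))

  colour≡⇒hue≡ : ∀ (w u : KVertex n k) → colour w ≡ colour u →
                 hue (proj₁ w) (proj₁ w ⊆? W) ≡ hue (proj₁ u) (proj₁ u ⊆? W)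
  colour≡⇒hue≡ w u eq = begin
    hue (proj₁ w) (proj₁ w ⊆? W)  ≡⟨ toℕ-fromℕ< _ ⟨
    toℕ (colour w)                ≡⟨ cong toℕ eq ⟩
    toℕ (colour u)                ≡⟨ toℕ-fromℕ< _ ⟩
    hue (proj₁ u) (proj₁ u ⊆? W)  ∎
    where open ≡-Reasoning

  conflictFree : IsCompleteCFColoring n k (k + 2) colour
  conflictFree (v , ∣v∣≡k) = colour T , T , T-adj , refl , T-unique
    where
    a : Subset n
    a = W ─ v

    k≤∣a∣ : k ≤ ∣ a ∣
    k≤∣a∣ = +-cancelʳ-≤ k k ∣ a ∣
              (subst₂ (λ s t → s ≤ ∣ a ∣ + t) (∣below∣≡r n (k + k) 2k≤n) ∣v∣≡k (∣p∣≤∣p─q∣+∣q∣ W v))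

    top : ∃ λ j → ∣ from j a ∣ ≡ k × lead (from j a) ≡ j
    top = topSegment k a 1≤k k≤∣a∣

    j : ℕ
    j = proj₁ top

    ∣T∣≡k : ∣ from j a ∣ ≡ k
    ∣T∣≡k = proj₁ (proj₂ top)

    leadT≡j : lead (from j a) ≡ j
    leadT≡j = proj₂ (proj₂ top)

    -- T is the set of the k largest elements of W ─ v.
    T : KVertex n k
    T = from j a , ∣T∣≡k

    T⊆a : from j a ⊆ a
    T⊆a = from-⊆ j a

    T-adj : KAdj (v , ∣v∣≡k) T
    T-adj (x , x∈v∩T) = let (x∈v , x∈T) = x∈p∩q⁻ v (from j a) x∈v∩T
                        in ∈─⇒∉ W v (T⊆a x∈T) x∈v

    T⊆W : from j a ⊆ W
    T⊆W = p─q⊆p W v ∘ T⊆a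

    hueT≡j : hue (proj₁ T) (proj₁ T ⊆? W) ≡ j
    hueT≡j = trans (hue-⊆ T⊆W (from j a ⊆? W)) leadT≡j

    j≤k : j ≤ k
    j≤k = subst (_≤ k) leadT≡j (lead≤k T⊆W ∣T∣≡k)

    T-unique : (w : KVertex n k) → KAdj (v , ∣v∣≡k) w → colour w ≡ colour T → proj₁ w ≡ from j a
    T-unique (w , ∣w∣≡k) w-adj same = ⊆-size-≡ w⊆T (≤-reflexive (trans ∣T∣≡k (sym ∣w∣≡k)))
      where
      inW : w ⊆ W × lead w ≡ j
      inW = hue≤k (w ⊆? W) (trans (colour≡⇒hue≡ (w , ∣w∣≡k) T same) hueT≡j) j≤k
      w⊆a : w ⊆ a
      w⊆a x∈w = x∈p∧x∉q⇒x∈p─q (proj₁ inW x∈w) (λ x∈v → w-adj (_ , x∈p∩q⁺ (x∈v , x∈w)))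
      w⊆T : w ⊆ from j a
      w⊆T = ⊆-from j (≤-reflexive (sym (proj₂ inW))) w⊆a

2k≤3k∸1 : ∀ {k} → 1 ≤ k → k + k ≤ 3 * k ∸ 1
2k≤3k∸1 {suc k} _ = ≤-trans (≤-reflexive (cong (suc k +_) (sym (+-identityʳ (suc k))))) (m≤n+m _ k)

lemma7 : (n k : ℕ) → 1 ≤ k → 3 * k ∸ 1 ≤ n → HasCompleteCFColoring n k (k + 2)
lemma7 n k 1≤k 3k∸1≤n = colour , conflictFree
  where open ConflictFree 1≤k (≤-trans (2k≤3k∸1 1≤k) 3k∸1≤n)
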